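{- Let $(D,X)$ be a dessin d'enfant with edge set $\mathcal E$ and monodromy pair $(\sigma_\circ,\sigma_\bullet)$, let $a,b\in\mathcal E$ be distinct, and assume $(\sigma_\circ,\sigma_\bullet)$ is Tame Exceptional relative to $(a,b)$. Let $t$ be the transposition exchanging $a$ and $b$ and let $(D^t,X^t)$ be a nondegenerate model for $(\sigma_\circ^t,\sigma_\bullet)$. Then $D^t$ is connected if and only if there is a walk in $D\setminus(a\cup b)$ from $\circ_a$ to $\bullet_a$ or a walk in $D\setminus(a\cup b)$ from $\circ_b$ to $\bullet_b$.
   Context: Permutations compose functionally, $\pi^s=s\pi s^{ -1}$. A bicolored graph is a finite multigraph with each vertex coloured white or black, every edge joining a white and a black vertex; $\circ_e,\bullet_e$ denote the white and black vertex of edge $e$; nondegenerate means every vertex is incident to an edge. $D\setminus(a\cup b)$ has the same vertices as $D$ and all edges except $a,b$. A dessin d'famille is a bicolored graph embedded in a connected oriented compact surface without boundary; its monodromy pair: $\sigma_\circ$ (resp. $\sigma_\bullet$) sends each edge to the next edge around its white (resp. black) vertex in the orientation's cyclic order. A dessin d'enfant is a dessin d'famille with nondegenerate graph whose complement is a disjoint union of open discs. A model for a pair $(x,y)$ in $S_{\mathcal E}$ is a dessin d'famille with edge set $\mathcal E$ and monodromy pair $(x,y)$. Tame Exceptional relative to $(a,b)$ (orbits and cycles of $\sigma_\circ\sigma_\bullet$; for $x$, list its cycle as $x=c_0,c_1=\sigma_\circ\sigma_\bullet(c_0),\dots$ and let $i_x(y)$ be the index of $y$): either (#1B) $\sigma_\circ(a),\sigma_\circ(b),b$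 lie in the cycle of $a$ with $0<i_a(\sigma_\circ(a))<i_a(\sigma_\circ(b))\le i_a(b)$; or (#1A) the same with $a,b$ exchanged; or (#2) $a,b$ lie in one orbit, $\sigma_\circ(a),\sigma_\circ(b)$ lie in one orbit, and these orbits differ. -}

module Defs where

open import Data.Nat using (ℕ; zero; suc; _<_; _≤_)
open import Data.Fin using (Fin)
open import Data.Fin.Permutation using (Permutation′; _⟨$⟩ʳ_; transpose)
open import Data.Product using (Σ; ∃; ∃-syntax; _×_; _,_)
open import Data.Sum using (_⊎_)
open import Data.Unit using (⊤)
open import Relation.Binary.PropositionalEquality using (_≡_; _≢_)
open import Relation.Nullary using (¬_)

iter : ∀ {A : Set} → (A → A) → ℕ → A → A
iter f zero    x = x
iter f (suc k) x = f (iter f k x)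

module _ {n : ℕ} where

  _∙_ : Permutation′ n → Permutation′ n → Fin n → Fin n
  (π ∙ ρ) e = π ⟨$⟩ʳ (ρ ⟨$⟩ʳ e)

  -- conjugation π^s = s π s⁻¹, as a function on edges
  conj : Permutation′ n → Permutation′ n → Fin n → Fin n
  conj π s e = s ⟨$⟩ʳ (π ⟨$⟩ʳ (Data.Fin.Permutation._⟨$⟩ˡ_ s e))

  SameOrbit : (Fin n → Fin n) → Fin n → Fin n → Set
  SameOrbit f x y = ∃[ k ] iter f k x ≡ y

  CycleIndex : (Fin n → Fin n) → Fin n → Fin n → ℕ → Set
  CycleIndex f x y k = iter f k x ≡ y × (∀ j → j < k → iter f j x ≢ y)

  Cond1 : Permutation′ n → Permutation′ n → Fin n → Fin n → Set
  Cond1 σw σb a b =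
    ∃[ i ] ∃[ j ] ∃[ l ]
      ( CycleIndex (σw ∙ σb) a (σw ⟨$⟩ʳ a) i
      × CycleIndex (σw ∙ σb) a (σw ⟨$⟩ʳ b) j
      × CycleIndex (σw ∙ σb) a b l
      × 0 < i × i < j × j ≤ l )

  Cond2 : Permutation′ n → Permutation′ n → Fin n → Fin n → Set
  Cond2 σw σb a b =
      SameOrbit (σw ∙ σb) a b
    × SameOrbit (σw ∙ σb) (σw ⟨$⟩ʳ a) (σw ⟨$⟩ʳ b)
    × ¬ SameOrbit (σw ∙ σb) a (σw ⟨$⟩ʳ a)

  TameExceptional : Permutation′ n → Permutation′ n → Fin n → Fin n → Set
  TameExceptional σw σb a b = Cond1 σw σb a b ⊎ Cond1 σw σb b a ⊎ Cond2 σw σb a b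

  -- The bicolored graph of a nondegenerate dessin with monodromy (x , y):
  -- edges = Fin n; white vertices = cycles of x, black vertices = cycles of y;
  -- edge e joins ∘_e (the x-cycle of e) and •_e (the y-cycle of e).
  -- A vertex is named by a colour and an incident edge.

  data Vtx : Set where
    ∘[_] : Fin n → Vtx
    •[_] : Fin n → Vtx

  data SameVtx (x y : Fin n → Fin n) : Vtx → Vtx → Set where
    sameW : ∀ {e f} → SameOrbit x e f → SameVtx x y ∘[ e ] ∘[ f ]
    sameB : ∀ {e f} → SameOrbit y e f → SameVtx x y •[ e ] •[ f ]

  data Walk (x y : Fin n → Fin n) (allowed : Fin n → Set) : Vtx → Vtx → Set where
    stop  : ∀ {u v} → SameVtx x y u v → Walk x y allowed u v
    viaWB : ∀ {u v} (e : Fin n) → allowed e → SameVtx x y u ∘[ e ] →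
            Walk x y allowed •[ e ] v → Walk x y allowed u v
    viaBW : ∀ {u v} (e : Fin n) → allowed e → SameVtx x y u •[ e ] →
            Walk x y allowed ∘[ e ] v → Walk x y allowed u v

  Connected : (Fin n → Fin n) → (Fin n → Fin n) → Set
  Connected x y = ∀ u v → Walk x y (λ _ → ⊤) u v

  NotAB : Fin n → Fin n → Fin n → Set
  NotAB a b e = e ≢ a × e ≢ b

  IsDessinDEnfant : Permutation′ n → Permutation′ n → Set
  IsDessinDEnfant σw σb = Connected (σw ⟨$⟩ʳ_) (σb ⟨$⟩ʳ_)

module Submission where

-- Conjugating σ∘ by t = (a b) only exchanges the white ends of a and b: Dᵗ is D ∖ (a ∪ b)
-- together with an edge ∘_b – •_a and an edge ∘_a – •_b.  Hence a walk ∘_a ⇝ •_a or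
-- ∘_b ⇝ •_b avoiding a and b lets every edge of D be rerouted inside Dᵗ, so Dᵗ inherits
-- connectedness from D.  Conversely, the vertices reachable in D ∖ (a ∪ b) from ∘_a or •_b
-- are closed under the edges of Dᵗ unless ∘_b or •_a is one of them; since Dᵗ joins ∘_a to
-- •_a, this forces ∘_a ⇝ •_a, ∘_b ⇝ •_b, ∘_a ⇝ ∘_b or •_a ⇝ •_b in D ∖ (a ∪ b).  The last
-- two imply one of the first two by tame exceptionality: walking along the face (cycle of
-- σ∘σ•) of a, from σ∘(a) in case #1 and from •_a in case #2, up to the first edge in {a, b}
-- joins some white end of a, b to some black end of a, b in D ∖ (a ∪ b).

open import Defs
open import Data.Nat using (ℕ; zero; suc; _+_; _*_; _∸_; _<_; _≤_; z≤n; s≤s)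
open import Data.Nat.Properties
  using (n<1+n; +-suc; +-comm; *-suc; <⇒≤; ≤-trans; ≤-reflexive; ∸-monoʳ-<; m∸n+n≡m;
         m≤n+m; +-monoˡ-≤; <-≤-trans; ≤-<-trans; m≤n⇒∃[o]m+o≡n)
open import Data.Fin using (Fin; toℕ)
open import Data.Fin.Properties using (pigeonhole; _≟_)
open import Data.Fin.Permutation using (Permutation′; _⟨$⟩ʳ_; transpose; flip; _∘ₚ_)
import Data.Fin.Permutation.Components as PC
open import Data.Product using (∃; ∃₂; ∃-syntax; _×_; _,_; proj₁; proj₂)
import Data.Product as Prod
import Data.Sum as Sum
open import Data.Sum using (_⊎_; inj₁; inj₂)
open import Data.Empty using (⊥-elim)
open import Data.Unit using (⊤)
open import Function.Base using (_∘_)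
open import Function.Bundles using (_⇔_; mk⇔; Injection)
open import Function.Definitions using (Injective)
open import Function.Properties.Inverse using (↔⇒↣)
open import Relation.Nullary using (¬_; Dec; yes; no)
open import Relation.Nullary.Decidable using (¬?; _×-dec_)
open import Relation.Unary using (Decidable)
open import Relation.Binary.PropositionalEquality

module _ {A : Set} (f : A → A) where

  iter-+ : ∀ m k x → iter f (m + k) x ≡ iter f m (iter f k x)
  iter-+ zero    k x = refl
  iter-+ (suc m) k x = cong f (iter-+ m k x)

  iter-shift : ∀ k x → iter f k (f x) ≡ iter f (suc k) x
  iter-shift zero    x = refl
  iter-shift (suc k) x = cong f (iter-shift k x)

  iter-periodic : ∀ {q x} → iter f q x ≡ x → ∀ m → iter f (m * q) x ≡ x
  iter-periodic         fixed zero    = refl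
  iter-periodic {q} {x} fixed (suc m) =
    trans (iter-+ q (m * q) x) (trans (cong (iter f q) (iter-periodic fixed m)) fixed)

  iter-injective : Injective _≡_ _≡_ f → ∀ m {x y} → iter f m x ≡ iter f m y → x ≡ y
  iter-injective f-inj zero    eq = eq
  iter-injective f-inj (suc m) eq = iter-injective f-inj m (f-inj eq)

module _ {n : ℕ} {f : Fin n → Fin n} where

  SameOrbit-refl : ∀ {x} → SameOrbit f x x
  SameOrbit-refl = 0 , refl

  SameOrbit-trans : ∀ {x y z} → SameOrbit f x y → SameOrbit f y z → SameOrbit f x z
  SameOrbit-trans {x} (k , fᵏx≡y) (m , fᵐy≡z) =
    m + k , trans (iter-+ f m k x) (trans (cong (iter f m) fᵏx≡y) fᵐy≡z)

  cycleIndex-interior : ∀ {a b l p} → CycleIndex f a b l → 0 < p → p < l →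
                        NotAB a b (iter f p a)
  cycleIndex-interior {a} {b} {l} {p} (fˡa≡b , minimal) 0<p p<l = returns-not , minimal p p<l
    where
      open ≡-Reasoning
      returns-not : iter f p a ≢ a
      returns-not fᵖa≡a = minimal (l ∸ p) (∸-monoʳ-< 0<p (<⇒≤ p<l)) (begin
        iter f (l ∸ p) a              ≡⟨ cong (iter f (l ∸ p)) fᵖa≡a ⟨
        iter f (l ∸ p) (iter f p a)   ≡⟨ iter-+ f (l ∸ p) p a ⟨
        iter f (l ∸ p + p) a          ≡⟨ cong (λ m → iter f m a) (m∸n+n≡m (<⇒≤ p<l)) ⟩
        iter f l a                    ≡⟨ fˡa≡b ⟩
        b                             ∎)

  module _ (f-inj : Injective _≡_ _≡_ f) where

    iter-period : ∀ x → ∃ λ p → iter f (suc p) x ≡ x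
    iter-period x with pigeonhole (n<1+n n) (λ i → iter f (toℕ i) x)
    ... | i , j , i<j , fⁱx≡fʲx with m≤n⇒∃[o]m+o≡n i<j
    ...   | o , i+o≡j = o , iter-injective f f-inj (toℕ i) (begin
            iter f (toℕ i) (iter f (suc o) x)   ≡⟨ iter-+ f (toℕ i) (suc o) x ⟨
            iter f (toℕ i + suc o) x           ≡⟨ cong (λ m → iter f m x) (trans (+-suc (toℕ i) o) i+o≡j) ⟩
            iter f (toℕ j) x                   ≡⟨ fⁱx≡fʲx ⟨
            iter f (toℕ i) x                   ∎)
      where open ≡-Reasoning

    SameOrbit-sym : ∀ {x y} → SameOrbit f x y → SameOrbit f y x
    SameOrbit-sym {x} {y} (k , fᵏx≡y) with iter-period x
    ... | p , periodic = k * p , (begin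
        iter f (k * p) y              ≡⟨ cong (iter f (k * p)) fᵏx≡y ⟨
        iter f (k * p) (iter f k x)   ≡⟨ iter-+ f (k * p) k x ⟨
        iter f (k * p + k) x          ≡⟨ cong (λ m → iter f m x) (trans (+-comm (k * p) k) (sym (*-suc k p))) ⟩
        iter f (k * suc p) x          ≡⟨ iter-periodic f periodic k ⟩
        x                             ∎)
      where open ≡-Reasoning

module _ {n : ℕ} {x y : Fin n → Fin n} where

  SameVtx-refl : ∀ {u} → SameVtx x y u u
  SameVtx-refl {∘[ e ]} = sameW SameOrbit-refl
  SameVtx-refl {•[ e ]} = sameB SameOrbit-refl

  SameVtx-trans : ∀ {u v w} → SameVtx x y u v → SameVtx x y v w → SameVtx x y u w
  SameVtx-trans (sameW o) (sameW o′) = sameW (SameOrbit-trans o o′)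
  SameVtx-trans (sameB o) (sameB o′) = sameB (SameOrbit-trans o o′)

  ≡⇒sameW : ∀ {e e′} → e ≡ e′ → SameVtx x y ∘[ e ] ∘[ e′ ]
  ≡⇒sameW e≡e′ = sameW (0 , e≡e′)

  module _ {P : Fin n → Set} where

    infixr 5 _◅_ _++_

    _◅_ : ∀ {u v w} → SameVtx x y u v → Walk x y P v w → Walk x y P u w
    s ◅ stop s′          = stop (SameVtx-trans s s′)
    s ◅ viaWB e p s′ q   = viaWB e p (SameVtx-trans s s′) q
    s ◅ viaBW e p s′ q   = viaBW e p (SameVtx-trans s s′) q

    _++_ : ∀ {u v w} → Walk x y P u v → Walk x y P v w → Walk x y P u w
    stop s         ++ r = s ◅ r
    viaWB e p s q  ++ r = viaWB e p s (q ++ r)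
    viaBW e p s q  ++ r = viaBW e p s (q ++ r)

    edge∘• : ∀ {e} → P e → Walk x y P ∘[ e ] •[ e ]
    edge∘• {e} p = viaWB e p SameVtx-refl (stop SameVtx-refl)

    edge•∘ : ∀ {e} → P e → Walk x y P •[ e ] ∘[ e ]
    edge•∘ {e} p = viaBW e p SameVtx-refl (stop SameVtx-refl)

    module _ (G : Vtx → Set)
             (G-resp : ∀ {u v} → SameVtx x y u v → G u → G v)
             (G-∘• : ∀ {e} → P e → G ∘[ e ] → G •[ e ])
             (G-•∘ : ∀ {e} → P e → G •[ e ] → G ∘[ e ]) where

      walk-preserves : ∀ {u v} → Walk x y P u v → G u → G v
      walk-preserves (stop s)        g = G-resp s g
      walk-preserves (viaWB e p s q) g = walk-preserves q (G-∘• p (G-resp s g))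
      walk-preserves (viaBW e p s q) g = walk-preserves q (G-•∘ p (G-resp s g))

  walk-map : ∀ {P Q : Fin n → Set} → (∀ {e} → P e → Q e) →
             ∀ {u v} → Walk x y P u v → Walk x y Q u v
  walk-map h (stop s)        = stop s
  walk-map h (viaWB e p s q) = viaWB e (h p) s (walk-map h q)
  walk-map h (viaBW e p s q) = viaBW e (h p) s (walk-map h q)

permutation-injective : ∀ {n} (π : Permutation′ n) → Injective _≡_ _≡_ (π ⟨$⟩ʳ_)
permutation-injective π = Injection.injective (↔⇒↣ π)

module PermutationWalks {n : ℕ} (σ τ : Permutation′ n) where

  private
    x y : Fin n → Fin n
    x = σ ⟨$⟩ʳ_
    y = τ ⟨$⟩ʳ_

  SameVtx-sym : ∀ {u v} → SameVtx x y u v → SameVtx x y v u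
  SameVtx-sym (sameW o) = sameW (SameOrbit-sym (permutation-injective σ) o)
  SameVtx-sym (sameB o) = sameB (SameOrbit-sym (permutation-injective τ) o)

  reverse : ∀ {P u v} → Walk x y P u v → Walk x y P v u
  reverse (stop s)        = stop (SameVtx-sym s)
  reverse (viaWB e p s q) = reverse q ++ edge•∘ p ++ stop (SameVtx-sym s)
  reverse (viaBW e p s q) = reverse q ++ edge∘• p ++ stop (SameVtx-sym s)

  module _ {x′ y′ : Fin n → Fin n} {P Q : Fin n → Set} (φ : Vtx → Vtx)
           (φ-resp : ∀ {u v} → SameVtx x′ y′ u v → SameVtx x y (φ u) (φ v))
           (φ-edge : ∀ {e} → P e → Walk x y Q (φ ∘[ e ]) (φ •[ e ])) where

    walk-transport : ∀ {u v} → Walk x′ y′ P u v → Walk x y Q (φ u) (φ v)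
    walk-transport (stop s)        = stop (φ-resp s)
    walk-transport (viaWB e p s q) = φ-resp s ◅ φ-edge p ++ walk-transport q
    walk-transport (viaBW e p s q) = φ-resp s ◅ reverse (φ-edge p) ++ walk-transport q

  face : Fin n → Fin n
  face = σ ∙ τ

  face-injective : Injective _≡_ _≡_ face
  face-injective = permutation-injective (τ ∘ₚ σ)

  module _ {P : Fin n → Set} where

    white-to-black : ∀ {e} → P e → Walk x y P ∘[ e ] •[ y e ]
    white-to-black p = edge∘• p ++ stop (sameB (1 , refl))

    black-to-white : ∀ {e} → P (y e) → Walk x y P •[ e ] ∘[ face e ]
    black-to-white p = sameB (1 , refl) ◅ edge•∘ p ++ stop (sameW (1 , refl))

  module _ {P : Fin n → Set} (P? : Decidable P) where

    face-walk∘ : ∀ m e → (∀ k → k ≤ m → P (iter face k e)) → ¬ P (y (iter face m e)) →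
                 ∃[ c ] ¬ P c × Walk x y P ∘[ e ] •[ c ]
    face-walk∘ zero    e allowed exit = y e , exit , white-to-black (allowed 0 z≤n)
    face-walk∘ (suc m) e allowed exit with P? (y e)
    ... | no  ¬p = y e , ¬p , white-to-black (allowed 0 z≤n)
    ... | yes p  = Prod.map₂ (Prod.map₂ ((edge∘• (allowed 0 z≤n) ++ black-to-white p) ++_))
                     (face-walk∘ m (face e) allowed′ (exit ∘ subst (P ∘ y) (iter-shift face m e)))
      where
        allowed′ : ∀ k → k ≤ m → P (iter face k (face e))
        allowed′ k k≤m = subst P (sym (iter-shift face k e)) (allowed (suc k) (s≤s k≤m))

    face-walk• : ∀ m e → (∀ k → k ≤ m → P (y (iter face k e))) → ¬ P (iter face (suc m) e) →
                 ∃[ c ] ¬ P c × Walk x y P •[ e ] ∘[ c ]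
    face-walk• zero    e allowed exit = face e , exit , black-to-white (allowed 0 z≤n)
    face-walk• (suc m) e allowed exit with P? (face e)
    ... | no  ¬p = face e , ¬p , black-to-white (allowed 0 z≤n)
    ... | yes p  = Prod.map₂ (Prod.map₂ ((black-to-white (allowed 0 z≤n) ++ edge∘• p) ++_))
                     (face-walk• m (face e) allowed′ (exit ∘ subst P (iter-shift face (suc m) e)))
      where
        allowed′ : ∀ k → k ≤ m → P (y (iter face k (face e)))
        allowed′ k k≤m = subst (P ∘ y) (sym (iter-shift face k e)) (allowed (suc k) (s≤s k≤m))

NotAB? : ∀ {n} (a b : Fin n) → Decidable (NotAB a b)
NotAB? a b e = ¬? (e ≟ a) ×-dec ¬? (e ≟ b)

module Dessin {n : ℕ} (σw σb : Permutation′ n) where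

  open PermutationWalks σw σb

  Walk∖ : Fin n → Fin n → Vtx → Vtx → Set
  Walk∖ a b = Walk (σw ⟨$⟩ʳ_) (σb ⟨$⟩ʳ_) (NotAB a b)

  Bypassed : Fin n → Fin n → Set
  Bypassed a b = Walk∖ a b ∘[ a ] •[ a ] ⊎ Walk∖ a b ∘[ b ] •[ b ]

  Terminal : Fin n → Fin n → Fin n → Set
  Terminal a b c = c ≡ a ⊎ c ≡ b

  TerminalsLinked : Fin n → Fin n → Set
  TerminalsLinked a b =
    ∃₂ λ c c′ → Terminal a b c × Terminal a b c′ × Walk∖ a b ∘[ c ] •[ c′ ]

  forbidden⇒terminal : ∀ {a b c} → ¬ NotAB a b c → Terminal a b c
  forbidden⇒terminal {a} {b} {c} forbidden with c ≟ a | c ≟ b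
  ... | yes c≡a | _       = inj₁ c≡a
  ... | no  _   | yes c≡b = inj₂ c≡b
  ... | no  c≢a | no  c≢b = ⊥-elim (forbidden (c≢a , c≢b))

  cond1-linked : ∀ {a b} → Cond1 σw σb a b → ∃[ c ] Terminal a b c × Walk∖ a b ∘[ a ] •[ c ]
  cond1-linked (_ , zero , _ , _ , _ , _ , _ , () , _)
  cond1-linked {a} {b} (i , suc j , l , (fⁱa≡σa , _) , (fʲ⁺¹a≡σb , _) , b-at-l , 0<i , s≤s i≤j , j<l) =
    let c , forbidden , walk = face-walk∘ (NotAB? a b) (j ∸ i) (iter face i a) interior exit
    in  c , forbidden⇒terminal forbidden , sameW (1 , sym fⁱa≡σa) ◅ walk
    where
      interior : ∀ k → k ≤ j ∸ i → NotAB a b (iter face k (iter face i a))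
      interior k k≤j∸i = subst (NotAB a b) (iter-+ face k i a)
        (cycleIndex-interior b-at-l (<-≤-trans 0<i (m≤n+m i k))
          (≤-<-trans (≤-trans (+-monoˡ-≤ i k≤j∸i) (≤-reflexive (m∸n+n≡m i≤j))) j<l))

      open ≡-Reasoning
      exit : ¬ NotAB a b (σb ⟨$⟩ʳ iter face (j ∸ i) (iter face i a))
      exit (_ , ≢b) = ≢b (permutation-injective σw (begin
        iter face (suc (j ∸ i)) (iter face i a)   ≡⟨ iter-+ face (suc (j ∸ i)) i a ⟨
        iter face (suc (j ∸ i + i)) a             ≡⟨ cong (λ m → iter face (suc m) a) (m∸n+n≡m i≤j) ⟩
        iter face (suc j) a                       ≡⟨ fʲ⁺¹a≡σb ⟩
        σw ⟨$⟩ʳ b                                 ∎))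

  -- Under #2, σ∘ maps each black-to-white edge of the face of a into that face, whereas σ∘ a and
  -- σ∘ b lie off it; so none of these edges is a or b.
  cond2-linked : ∀ {a b} → a ≢ b → Cond2 σw σb a b → ∃[ c ] Terminal a b c × Walk∖ a b ∘[ c ] •[ a ]
  cond2-linked a≢b ((zero , a≡b) , _) = ⊥-elim (a≢b a≡b)
  cond2-linked {a} {b} _ ((suc m , fᵐ⁺¹a≡b) , σa~σb , a≁σa) =
    let c , forbidden , walk = face-walk• (NotAB? a b) m a avoids (λ (_ , ≢b) → ≢b fᵐ⁺¹a≡b)
    in  c , forbidden⇒terminal forbidden , reverse walk
    where
      avoids : ∀ k → k ≤ m → NotAB a b (σb ⟨$⟩ʳ iter face k a)
      avoids k _ =
          (λ ≡a → a≁σa (suc k , cong (σw ⟨$⟩ʳ_) ≡a))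
        , (λ ≡b → a≁σa (SameOrbit-trans (suc k , cong (σw ⟨$⟩ʳ_) ≡b) (SameOrbit-sym face-injective σa~σb)))

  tameExceptional⇒linked : ∀ {a b} → a ≢ b → TameExceptional σw σb a b → TerminalsLinked a b
  tameExceptional⇒linked {a} _ (inj₁ cond1) =
    let c , terminal , walk = cond1-linked cond1 in a , c , inj₁ refl , terminal , walk
  tameExceptional⇒linked {b = b} _ (inj₂ (inj₁ cond1)) =
    let c , terminal , walk = cond1-linked cond1
    in  b , c , inj₂ refl , Sum.swap terminal , walk-map Prod.swap walk
  tameExceptional⇒linked {a} a≢b (inj₂ (inj₂ cond2)) =
    let c , terminal , walk = cond2-linked a≢b cond2 in c , a , terminal , inj₁ refl , walk

  linked-whites⇒bypassed : ∀ {a b} → TerminalsLinked a b → Walk∖ a b ∘[ a ] ∘[ b ] → Bypassed a b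
  linked-whites⇒bypassed (_ , _ , inj₁ refl , inj₁ refl , p) _     = inj₁ p
  linked-whites⇒bypassed (_ , _ , inj₂ refl , inj₂ refl , p) _     = inj₂ p
  linked-whites⇒bypassed (_ , _ , inj₁ refl , inj₂ refl , p) ∘a∘b = inj₂ (reverse ∘a∘b ++ p)
  linked-whites⇒bypassed (_ , _ , inj₂ refl , inj₁ refl , p) ∘a∘b = inj₁ (∘a∘b ++ p)

  linked-blacks⇒bypassed : ∀ {a b} → TerminalsLinked a b → Walk∖ a b •[ a ] •[ b ] → Bypassed a b
  linked-blacks⇒bypassed (_ , _ , inj₁ refl , inj₁ refl , p) _     = inj₁ p
  linked-blacks⇒bypassed (_ , _ , inj₂ refl , inj₂ refl , p) _     = inj₂ p
  linked-blacks⇒bypassed (_ , _ , inj₁ refl , inj₂ refl , p) •a•b = inj₁ (p ++ reverse •a•b)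
  linked-blacks⇒bypassed (_ , _ , inj₂ refl , inj₁ refl , p) •a•b = inj₂ (p ++ •a•b)

transpose-matchˡ : ∀ {n} (i j : Fin n) → PC.transpose i j i ≡ j
transpose-matchˡ i j with i ≟ i
... | yes _ = refl
... | no i≢i = ⊥-elim (i≢i refl)

transpose-matchʳ : ∀ {n} (i j : Fin n) → PC.transpose i j j ≡ i
transpose-matchʳ i j with j ≟ i
... | yes j≡i = j≡i
... | no _ with j ≟ j
...   | yes _ = refl
...   | no j≢j = ⊥-elim (j≢j refl)

transpose-fixes : ∀ {n} {i j k : Fin n} → k ≢ i → k ≢ j → PC.transpose i j k ≡ k
transpose-fixes {i = i} {j} {k} k≢i k≢j with k ≟ i
... | yes k≡i = ⊥-elim (k≢i k≡i)
... | no _ with k ≟ j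
...   | yes k≡j = ⊥-elim (k≢j k≡j)
...   | no _ = refl

-- A permutation whose action is definitionally conj π s.
conjugate : ∀ {n} → Permutation′ n → Permutation′ n → Permutation′ n
conjugate π s = flip s ∘ₚ π ∘ₚ s

module Transposed {n : ℕ} (σw σb : Permutation′ n) (a b : Fin n) where

  open Dessin σw σb
  open PermutationWalks σw σb using (reverse)

  σwᵗ : Permutation′ n
  σwᵗ = conjugate σw (transpose a b)

  module Dᵗ = PermutationWalks σwᵗ σb

  private
    t t⁻¹ : Fin n → Fin n
    t   = PC.transpose a b
    t⁻¹ = PC.transpose b a

  Walkᵗ : Vtx → Vtx → Set
  Walkᵗ = Walk (σwᵗ ⟨$⟩ʳ_) (σb ⟨$⟩ʳ_) (λ _ → ⊤)

  iter-conjugate : ∀ k e → iter (σwᵗ ⟨$⟩ʳ_) k (t e) ≡ t (iter (σw ⟨$⟩ʳ_) k e)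
  iter-conjugate zero    e = refl
  iter-conjugate (suc k) e =
    trans (cong (λ e′ → t (σw ⟨$⟩ʳ t⁻¹ e′)) (iter-conjugate k e))
          (cong (λ e′ → t (σw ⟨$⟩ʳ e′)) (PC.transpose-inverse b a))

  iter-conjugate⁻¹ : ∀ k e → iter (σw ⟨$⟩ʳ_) k (t⁻¹ e) ≡ t⁻¹ (iter (σwᵗ ⟨$⟩ʳ_) k e)
  iter-conjugate⁻¹ zero    e = refl
  iter-conjugate⁻¹ (suc k) e =
    trans (cong (σw ⟨$⟩ʳ_) (iter-conjugate⁻¹ k e)) (sym (PC.transpose-inverse b a))

  -- White vertices of D are cycles of σ∘, those of Dᵗ cycles of t σ∘ t⁻¹; t maps the former to the latter.
  toᵗ fromᵗ : Vtx → Vtx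
  toᵗ ∘[ e ]   = ∘[ t e ]
  toᵗ •[ e ]   = •[ e ]
  fromᵗ ∘[ e ] = ∘[ t⁻¹ e ]
  fromᵗ •[ e ] = •[ e ]

  toᵗ-resp : ∀ {u v} → SameVtx (σw ⟨$⟩ʳ_) (σb ⟨$⟩ʳ_) u v → SameVtx (σwᵗ ⟨$⟩ʳ_) (σb ⟨$⟩ʳ_) (toᵗ u) (toᵗ v)
  toᵗ-resp (sameW (k , eq)) = sameW (k , trans (iter-conjugate k _) (cong t eq))
  toᵗ-resp (sameB o)        = sameB o

  fromᵗ-resp : ∀ {u v} → SameVtx (σwᵗ ⟨$⟩ʳ_) (σb ⟨$⟩ʳ_) u v → SameVtx (σw ⟨$⟩ʳ_) (σb ⟨$⟩ʳ_) (fromᵗ u) (fromᵗ v)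
  fromᵗ-resp (sameW (k , eq)) = sameW (k , trans (iter-conjugate⁻¹ k _) (cong t⁻¹ eq))
  fromᵗ-resp (sameB o)        = sameB o

  toᵗ∘fromᵗ : ∀ u → SameVtx (σwᵗ ⟨$⟩ʳ_) (σb ⟨$⟩ʳ_) u (toᵗ (fromᵗ u))
  toᵗ∘fromᵗ ∘[ e ] = ≡⇒sameW (sym (PC.transpose-inverse a b))
  toᵗ∘fromᵗ •[ e ] = SameVtx-refl

  kept-edge : ∀ {e} → NotAB a b e → Walkᵗ (toᵗ ∘[ e ]) •[ e ]
  kept-edge (e≢a , e≢b) = ≡⇒sameW (transpose-fixes e≢a e≢b) ◅ edge∘• _

  swapped-edgeᵃ : Walkᵗ (toᵗ ∘[ b ]) •[ a ]
  swapped-edgeᵃ = ≡⇒sameW (transpose-matchʳ a b) ◅ edge∘• _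

  swapped-edgeᵇ : Walkᵗ (toᵗ ∘[ a ]) •[ b ]
  swapped-edgeᵇ = ≡⇒sameW (transpose-matchˡ a b) ◅ edge∘• _

  lift∖ : ∀ {u v} → Walk∖ a b u v → Walkᵗ (toᵗ u) (toᵗ v)
  lift∖ = Dᵗ.walk-transport toᵗ toᵗ-resp kept-edge

  rerouted-a-b : Bypassed a b → Walkᵗ (toᵗ ∘[ a ]) •[ a ] × Walkᵗ (toᵗ ∘[ b ]) •[ b ]
  rerouted-a-b (inj₁ p) = lift∖ p , swapped-edgeᵃ ++ Dᵗ.reverse (lift∖ p) ++ swapped-edgeᵇ
  rerouted-a-b (inj₂ q) = swapped-edgeᵇ ++ Dᵗ.reverse (lift∖ q) ++ swapped-edgeᵃ , lift∖ q

  rerouted-edge : Bypassed a b → ∀ {e} → ⊤ → Walkᵗ (toᵗ ∘[ e ]) (toᵗ •[ e ])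
  rerouted-edge bypassed {e} _ = reroute (e ≟ a) (e ≟ b)
    where
      reroute : ∀ {e} → Dec (e ≡ a) → Dec (e ≡ b) → Walkᵗ (toᵗ ∘[ e ]) •[ e ]
      reroute (yes refl) _          = proj₁ (rerouted-a-b bypassed)
      reroute (no _)     (yes refl) = proj₂ (rerouted-a-b bypassed)
      reroute (no e≢a)   (no e≢b)   = kept-edge (e≢a , e≢b)

  connected-if-bypassed : Connected (σw ⟨$⟩ʳ_) (σb ⟨$⟩ʳ_) → Bypassed a b → Connected (σwᵗ ⟨$⟩ʳ_) (σb ⟨$⟩ʳ_)
  connected-if-bypassed connected bypassed u v =
    toᵗ∘fromᵗ u ◅ Dᵗ.walk-transport toᵗ toᵗ-resp (rerouted-edge bypassed) (connected (fromᵗ u) (fromᵗ v))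
                ++ stop (Dᵗ.SameVtx-sym (toᵗ∘fromᵗ v))

  Reached : Vtx → Set
  Reached v = Bypassed a b ⊎ (Walk∖ a b ∘[ a ] v ⊎ Walk∖ a b •[ b ] v)

  Reached-++ : ∀ {u v} → Walk∖ a b u v → Reached u → Reached v
  Reached-++ q (inj₁ bypassed)   = inj₁ bypassed
  Reached-++ q (inj₂ (inj₁ p))   = inj₂ (inj₁ (p ++ q))
  Reached-++ q (inj₂ (inj₂ p))   = inj₂ (inj₂ (p ++ q))

  reached-∘b⇒bypassed : TerminalsLinked a b → Reached ∘[ b ] → Bypassed a b
  reached-∘b⇒bypassed _      (inj₁ bypassed)  = bypassed
  reached-∘b⇒bypassed linked (inj₂ (inj₁ p))  = linked-whites⇒bypassed linked p
  reached-∘b⇒bypassed _      (inj₂ (inj₂ q))  = inj₂ (reverse q)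

  reached-•a⇒bypassed : TerminalsLinked a b → Reached •[ a ] → Bypassed a b
  reached-•a⇒bypassed _      (inj₁ bypassed)  = bypassed
  reached-•a⇒bypassed _      (inj₂ (inj₁ p))  = inj₁ p
  reached-•a⇒bypassed linked (inj₂ (inj₂ q))  = linked-blacks⇒bypassed linked (reverse q)

  reached-across-transposed-edge : TerminalsLinked a b → ∀ e →
    (Reached (fromᵗ ∘[ e ]) → Reached •[ e ]) × (Reached •[ e ] → Reached (fromᵗ ∘[ e ]))
  reached-across-transposed-edge linked e = across (e ≟ a) (e ≟ b)
    where
      across : ∀ {e} → Dec (e ≡ a) → Dec (e ≡ b) →
               (Reached (fromᵗ ∘[ e ]) → Reached •[ e ]) × (Reached •[ e ] → Reached (fromᵗ ∘[ e ]))
      across (yes refl) _ =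
          (λ r → inj₁ (reached-∘b⇒bypassed linked (Reached-++ (stop (≡⇒sameW (transpose-matchʳ b a))) r)))
        , (λ r → inj₁ (reached-•a⇒bypassed linked r))
      across (no _) (yes refl) =
          (λ _ → inj₂ (inj₂ (stop SameVtx-refl)))
        , (λ _ → inj₂ (inj₁ (stop (≡⇒sameW (sym (transpose-matchˡ b a))))))
      across (no e≢a) (no e≢b) =
          Reached-++ (stop (≡⇒sameW (transpose-fixes e≢b e≢a)) ++ edge∘• (e≢a , e≢b))
        , Reached-++ (edge•∘ (e≢a , e≢b) ++ stop (≡⇒sameW (sym (transpose-fixes e≢b e≢a))))

  bypassed-if-connected : TerminalsLinked a b → Connected (σwᵗ ⟨$⟩ʳ_) (σb ⟨$⟩ʳ_) → Bypassed a b
  bypassed-if-connected linked connectedᵗ =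
    reached-•a⇒bypassed linked
      (walk-preserves (Reached ∘ fromᵗ) (Reached-++ ∘ stop ∘ fromᵗ-resp)
        (λ {e} _ → proj₁ (reached-across-transposed-edge linked e))
        (λ {e} _ → proj₂ (reached-across-transposed-edge linked e))
        (connectedᵗ ∘[ b ] •[ a ])
        (inj₂ (inj₁ (stop (≡⇒sameW (sym (transpose-matchˡ b a)))))))

mainTheorem10 : (n : ℕ) (σw σb : Permutation′ n) (a b : Fin n) →
    IsDessinDEnfant σw σb →
    a ≢ b →
    TameExceptional σw σb a b →
    ( Connected (conj σw (transpose a b)) (σb ⟨$⟩ʳ_)
      ⇔ ( Walk (σw ⟨$⟩ʳ_) (σb ⟨$⟩ʳ_) (NotAB a b) ∘[ a ] •[ a ]
        ⊎ Walk (σw ⟨$⟩ʳ_) (σb ⟨$⟩ʳ_) (NotAB a b) ∘[ b ] •[ b ] ) )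
mainTheorem10 n σw σb a b connected a≢b tame =
  mk⇔ (bypassed-if-connected (tameExceptional⇒linked a≢b tame))
      (connected-if-bypassed connected)
  where
    open Dessin σw σb
    open Transposed σw σb a b
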